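{- Let $n \ge 1$, let $\pi$ be a permutation of $\{1, \ldots, n^2\}$ and let $x = (x_1, \ldots, x_{n^2})^T \in \mathbb{Z}^{n^2}$. The following are equivalent: (i) $A_\pi x <> \mathbf{0}$; (ii) for each $j = 1, \ldots, n$, the numbers $x_{\pi((j-1)n+1)}, \ldots, x_{\pi(jn)}$ are pairwise distinct.
   Context: For $y \in \mathbb{Z}^s$ write $y <> \mathbf{0}$ if every component of $y$ is nonzero. Let $s(n) = \sum_{i=1}^{n-1} i$. The $s(n) \times n$ matrix $A(n)$ is defined inductively: $A(1)$ is the empty matrix, and $A(n) = \begin{pmatrix} \mathbf{1}_{n-1} & -U_{n-1} \\ \mathbf{0}_{s(n-1)} & A(n-1) \end{pmatrix}$, where $\mathbf{1}_{n-1}$ is the all-ones column of length $n-1$, $U_{n-1}$ is the $(n-1)\times(n-1)$ identity matrix and $\mathbf{0}_{s(n-1)}$ is the zero column of length $s(n-1)$. Let $A$ be the $(n \cdot s(n)) \times n^2$ block-diagonal matrix whose $n$ diagonal blocks all equal $A(n)$ (all other entries zero). For a permutation $\pi$ of $\{1,\ldots,n^2\}$, $A_\pi$ denotes the matrix whose $j$-th column is the $\pi^{ -1}(j)$-th column of $A$, for $j = 1, \ldots, n^2$. -}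

module Defs where

open import Data.Nat using (ℕ; zero; suc; _+_; _*_)
open import Data.Integer using (ℤ; 0ℤ; 1ℤ; -1ℤ) renaming (_+_ to _+ℤ_; _*_ to _*ℤ_)
open import Data.Fin using (Fin; zero; suc; splitAt; quotRem; combine)
open import Data.Fin.Permutation using (Permutation′; _⟨$⟩ʳ_; _⟨$⟩ˡ_)
open import Data.Sum using (inj₁; inj₂)
open import Data.Product using (_,_)
open import Relation.Binary.PropositionalEquality using (_≡_; _≢_)
open import Relation.Nullary using (yes; no)
import Data.Fin as F

-- Convention: indices are 0-based (Fin), index i corresponds to i+1 in the paper.

-- s(n) = Σ_{i=1}^{n-1} i ; s 0 = 0, s (k+1) = k + s k.
s : ℕ → ℕ
s zero = 0
s (suc k) = k + s k

Matrix : ℕ → ℕ → Set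
Matrix m k = Fin m → Fin k → ℤ

-- A(n) : s(n) × n, defined inductively.
-- A(k+1) = ( 1_k   -U_k ; 0_{s k}  A(k) ), rows split as k + s k,
-- columns as 1 + k (first column, then the remaining k columns).
An : (n : ℕ) → Matrix (s n) n
An zero ()
An (suc k) r c with splitAt k r | c
... | inj₁ i  | zero  = 1ℤ
... | inj₁ i  | suc j with i F.≟ j
...   | yes _ = -1ℤ
...   | no  _ = 0ℤ
An (suc k) r c | inj₂ i' | zero  = 0ℤ
An (suc k) r c | inj₂ i' | suc j = An k i' j

-- The block-diagonal matrix A with n diagonal blocks A(n).
-- Row index (block b, row i) is combine b i = b * s(n) + i,
-- column index (block b', column j) is combine b' j = b' * n + j.
Ablock : (n : ℕ) → Matrix (n * s n) (n * n)
Ablock n r c with quotRem {n} (s n) r | quotRem {n} n c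
... | (i , b) | (j , b') with b F.≟ b'
...   | yes _ = An n i j
...   | no  _ = 0ℤ

Aπ : (n : ℕ) → Permutation′ (n * n) → Matrix (n * s n) (n * n)
Aπ n π r j = Ablock n r (π ⟨$⟩ˡ j)

sumFin : (m : ℕ) → (Fin m → ℤ) → ℤ
sumFin zero f = 0ℤ
sumFin (suc m) f = f zero +ℤ sumFin m (λ i → f (suc i))

mulVec : ∀ {m k} → Matrix m k → (Fin k → ℤ) → Fin m → ℤ
mulVec {m} {k} M x r = sumFin k (λ j → M r j *ℤ x j)

AllNonzero : ∀ {m} → (Fin m → ℤ) → Set
AllNonzero y = ∀ r → y r ≢ 0ℤ

BlocksDistinct : (n : ℕ) → Permutation′ (n * n) → (Fin (n * n) → ℤ) → Set
BlocksDistinct n π x =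
  ∀ (j k l : Fin n) → k ≢ l → x (π ⟨$⟩ʳ combine j k) ≢ x (π ⟨$⟩ʳ combine j l)

module Submission where

-- The rows of A(n) are indexed by pairs i < i′ and row (i,i′)
-- reads x_i - x_{i′}: by the recursive shape of A(k+1), its first k rows are
-- z₀ - z_{i+1} and the remaining rows are A(k) applied to the tail of z.
-- Hence, by induction on n, A(n) z <> 0 exactly when z is injective
-- (`An-nonzero⇔distinct`).  For the block matrix, reindexing the columns of A_π
-- by π and splitting them into n blocks shows that the rows of block b of A_π x
-- are the rows of A(n) applied to the b-th block of x ∘ π (`row-block`), so the
-- theorem is the conjunction over all blocks of the single-block statement.

open import Defs
open import Data.Nat using (ℕ; _*_; _≥_)
open import Data.Integer using (ℤ)
open import Data.Fin using (Fin)
open import Data.Fin.Permutation using (Permutation′)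
open import Function.Bundles using (_⇔_)

import Data.Nat as ℕ
open import Data.Integer using (0ℤ; 1ℤ; -1ℤ; -_; _-_) renaming (_+_ to _+ℤ_; _*_ to _*ℤ_)
open import Data.Integer.Properties
  using (+-0-commutativeMonoid; -1*i≡-i; i-j≡0⇒i≡j; i≡j⇒i-j≡0; *-identityˡ; +-identityʳ; +-identityˡ; +-assoc)
open import Data.Fin using (zero; suc; combine; remQuot; splitAt; _↑ˡ_; _↑ʳ_)
open import Data.Fin.Properties
  using (remQuot-combine; combine-remQuot; join-splitAt; splitAt-↑ˡ; splitAt-↑ʳ; suc-injective)
import Data.Fin as F
open import Data.Fin.Permutation using (_⟨$⟩ʳ_; _⟨$⟩ˡ_; inverseʳ) renaming (flip to inverse)
open import Data.Vec.Functional using (tail)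
open import Data.Sum using (inj₁; inj₂)
open import Data.Product using (_×_; _,_; proj₁; proj₂; swap)
open import Data.Product.Function.NonDependent.Propositional using (_×-⇔_)
open import Data.Empty using (⊥-elim)
open import Relation.Nullary using (yes; no)
open import Relation.Binary.PropositionalEquality
open import Function.Base using (_∘_)
open import Function.Bundles using (mk⇔; Equivalence)
open import Function.Properties.Equivalence using (⇔-setoid)
open import Level using (0ℓ)
import Relation.Binary.Reasoning.Setoid as SetoidReasoning
open import Algebra.Properties.CommutativeMonoid.Sum +-0-commutativeMonoid using (sum; sum-permute)

sumFin-cong : ∀ m {f g : Fin m → ℤ} → (∀ i → f i ≡ g i) → sumFin m f ≡ sumFin m g
sumFin-cong ℕ.zero    h = refl
sumFin-cong (ℕ.suc m) h = cong₂ _+ℤ_ (h zero) (sumFin-cong m (h ∘ suc))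

sumFin≡sum : ∀ m (f : Fin m → ℤ) → sumFin m f ≡ sum f
sumFin≡sum ℕ.zero    f = refl
sumFin≡sum (ℕ.suc m) f = cong (f zero +ℤ_) (sumFin≡sum m (tail f))

sumFin-permute : ∀ m (g : Fin m → ℤ) (π : Permutation′ m) →
  sumFin m (g ∘ (π ⟨$⟩ˡ_)) ≡ sumFin m g
sumFin-permute m g π = begin
  sumFin m (g ∘ (π ⟨$⟩ˡ_)) ≡⟨ sumFin≡sum m _ ⟩
  sum (g ∘ (π ⟨$⟩ˡ_))      ≡⟨ sum-permute g (inverse π) ⟨
  sum g                    ≡⟨ sumFin≡sum m g ⟨
  sumFin m g               ∎
  where open ≡-Reasoning

sumFin-zero : ∀ m (f : Fin m → ℤ) → (∀ i → f i ≡ 0ℤ) → sumFin m f ≡ 0ℤ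
sumFin-zero ℕ.zero    f h = refl
sumFin-zero (ℕ.suc m) f h = cong₂ _+ℤ_ (h zero) (sumFin-zero m (tail f) (h ∘ suc))

sumFin-delta : ∀ m (f : Fin m → ℤ) (b : Fin m) → (∀ b′ → b ≢ b′ → f b′ ≡ 0ℤ) →
  sumFin m f ≡ f b
sumFin-delta (ℕ.suc m) f zero h =
  trans (cong (f zero +ℤ_) (sumFin-zero m (tail f) (λ i → h (suc i) (λ ()))))
        (+-identityʳ (f zero))
sumFin-delta (ℕ.suc m) f (suc b) h =
  trans (cong₂ _+ℤ_ (h zero (λ ()))
                    (sumFin-delta m (tail f) b (λ b′ b≢b′ → h (suc b′) (b≢b′ ∘ suc-injective))))
        (+-identityˡ _)

sumFin-+ : ∀ a b (f : Fin (a ℕ.+ b) → ℤ) →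
  sumFin (a ℕ.+ b) f ≡ sumFin a (f ∘ (_↑ˡ b)) +ℤ sumFin b (f ∘ (a ↑ʳ_))
sumFin-+ ℕ.zero    b f = sym (+-identityˡ _)
sumFin-+ (ℕ.suc a) b f =
  trans (cong (f zero +ℤ_) (sumFin-+ a b (tail f))) (sym (+-assoc (f zero) _ _))

sumFin-* : ∀ m k (f : Fin (m ℕ.* k) → ℤ) →
  sumFin (m ℕ.* k) f ≡ sumFin m (λ b → sumFin k (f ∘ combine b))
sumFin-* ℕ.zero    k f = refl
sumFin-* (ℕ.suc m) k f =
  trans (sumFin-+ k (m ℕ.* k) f)
        (cong (sumFin k (f ∘ (_↑ˡ m ℕ.* k)) +ℤ_) (sumFin-* m k (f ∘ (k ↑ʳ_))))

AllNonzero-cong : ∀ {m} {y y′ : Fin m → ℤ} → (∀ r → y r ≡ y′ r) →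
  AllNonzero y ⇔ AllNonzero y′
AllNonzero-cong y≗y′ =
  mk⇔ (λ H r → H r ∘ trans (y≗y′ r)) (λ H r → H r ∘ trans (sym (y≗y′ r)))

AllNonzero-+ : ∀ a b (y : Fin (a ℕ.+ b) → ℤ) →
  AllNonzero y ⇔ (AllNonzero (y ∘ (_↑ˡ b)) × AllNonzero (y ∘ (a ↑ʳ_)))
AllNonzero-+ a b y = mk⇔ (λ H → H ∘ (_↑ˡ b) , H ∘ (a ↑ʳ_)) joined
  where
  joined : AllNonzero (y ∘ (_↑ˡ b)) × AllNonzero (y ∘ (a ↑ʳ_)) → AllNonzero y
  joined (Hˡ , Hʳ) r with splitAt a r | join-splitAt a b r
  ... | inj₁ i | refl = Hˡ i
  ... | inj₂ j | refl = Hʳ j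

AllNonzero-* : ∀ m k (y : Fin (m ℕ.* k) → ℤ) →
  AllNonzero y ⇔ (∀ b → AllNonzero (y ∘ combine b))
AllNonzero-* m k y = mk⇔ (λ H b → H ∘ combine b) blocks
  where
  blocks : (∀ b → AllNonzero (y ∘ combine b)) → AllNonzero y
  blocks H r = subst (λ r → y r ≢ 0ℤ) (combine-remQuot {m} k r)
                     (H (proj₁ (remQuot {m} k r)) (proj₂ (remQuot {m} k r)))

module ⇔-Reasoning = SetoidReasoning (⇔-setoid 0ℓ)

∀-⇔ : ∀ {I : Set} {P Q : I → Set} → (∀ i → P i ⇔ Q i) → (∀ i → P i) ⇔ (∀ i → Q i)
∀-⇔ P⇔Q = mk⇔ (λ p i → Equivalence.to (P⇔Q i) (p i)) (λ q i → Equivalence.from (P⇔Q i) (q i))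

Distinct : ∀ {m} → (Fin m → ℤ) → Set
Distinct {m} z = ∀ (k l : Fin m) → k ≢ l → z k ≢ z l

Distinct-suc : ∀ {m} (z : Fin (ℕ.suc m) → ℤ) →
  Distinct z ⇔ ((∀ i → z zero ≢ z (suc i)) × Distinct (tail z))
Distinct-suc z = mk⇔
  (λ D → (λ i → D zero (suc i) (λ ())) , (λ k l k≢l → D (suc k) (suc l) (k≢l ∘ suc-injective)))
  glue
  where
  glue : (∀ i → z zero ≢ z (suc i)) × Distinct (tail z) → Distinct z
  glue (head≢ , D) zero    zero    0≢0 = ⊥-elim (0≢0 refl)
  glue (head≢ , D) zero    (suc l) _   = head≢ l
  glue (head≢ , D) (suc k) zero    _   = head≢ k ∘ sym
  glue (head≢ , D) (suc k) (suc l) k≢l = D k l (k≢l ∘ cong suc)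

difference-nonzero : ∀ (a b : ℤ) → (a - b ≢ 0ℤ) ⇔ (a ≢ b)
difference-nonzero a b = mk⇔ (λ H a≡b → H (i≡j⇒i-j≡0 a≡b)) (λ a≢b → a≢b ∘ i-j≡0⇒i≡j a b)

module _ (k : ℕ) where

  An-top-first : ∀ (i : Fin k) → An (ℕ.suc k) (i ↑ˡ s k) zero ≡ 1ℤ
  An-top-first i rewrite splitAt-↑ˡ k i (s k) = refl

  An-top-diagonal : ∀ (i : Fin k) → An (ℕ.suc k) (i ↑ˡ s k) (suc i) ≡ -1ℤ
  An-top-diagonal i rewrite splitAt-↑ˡ k i (s k) with i F.≟ i
  ... | yes _   = refl
  ... | no  i≢i = ⊥-elim (i≢i refl)

  An-top-offDiagonal : ∀ (i j : Fin k) → i ≢ j → An (ℕ.suc k) (i ↑ˡ s k) (suc j) ≡ 0ℤ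
  An-top-offDiagonal i j i≢j rewrite splitAt-↑ˡ k i (s k) with i F.≟ j
  ... | yes i≡j = ⊥-elim (i≢j i≡j)
  ... | no  _   = refl

  An-bottom-first : ∀ (i : Fin (s k)) → An (ℕ.suc k) (k ↑ʳ i) zero ≡ 0ℤ
  An-bottom-first i rewrite splitAt-↑ʳ k (s k) i = refl

  An-bottom-rest : ∀ (i : Fin (s k)) j → An (ℕ.suc k) (k ↑ʳ i) (suc j) ≡ An k i j
  An-bottom-rest i j rewrite splitAt-↑ʳ k (s k) i = refl

  row-top : ∀ (z : Fin (ℕ.suc k) → ℤ) (i : Fin k) →
    mulVec (An (ℕ.suc k)) z (i ↑ˡ s k) ≡ z zero - z (suc i)
  row-top z i = cong₂ _+ℤ_ first rest
    where
    first : An (ℕ.suc k) (i ↑ˡ s k) zero *ℤ z zero ≡ z zero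
    first = trans (cong (_*ℤ z zero) (An-top-first i)) (*-identityˡ (z zero))
    rest : sumFin k (λ j → An (ℕ.suc k) (i ↑ˡ s k) (suc j) *ℤ z (suc j)) ≡ - z (suc i)
    rest = begin
      sumFin k (λ j → An (ℕ.suc k) (i ↑ˡ s k) (suc j) *ℤ z (suc j))
        ≡⟨ sumFin-delta k _ i (λ j i≢j → cong (_*ℤ z (suc j)) (An-top-offDiagonal i j i≢j)) ⟩
      An (ℕ.suc k) (i ↑ˡ s k) (suc i) *ℤ z (suc i)
        ≡⟨ cong (_*ℤ z (suc i)) (An-top-diagonal i) ⟩
      -1ℤ *ℤ z (suc i)
        ≡⟨ -1*i≡-i (z (suc i)) ⟩
      - z (suc i) ∎
      where open ≡-Reasoning

  row-bottom : ∀ (z : Fin (ℕ.suc k) → ℤ) (i : Fin (s k)) →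
    mulVec (An (ℕ.suc k)) z (k ↑ʳ i) ≡ mulVec (An k) (tail z) i
  row-bottom z i =
    trans (cong₂ _+ℤ_ (cong (_*ℤ z zero) (An-bottom-first i))
                      (sumFin-cong k (λ j → cong (_*ℤ z (suc j)) (An-bottom-rest i j))))
          (+-identityˡ _)

An-nonzero⇔distinct : ∀ n (z : Fin n → ℤ) → AllNonzero (mulVec (An n) z) ⇔ Distinct z
An-nonzero⇔distinct ℕ.zero    z = mk⇔ (λ _ ()) (λ _ ())
An-nonzero⇔distinct (ℕ.suc k) z = begin
  AllNonzero (mulVec (An (ℕ.suc k)) z)
    ≈⟨ AllNonzero-+ k (s k) (mulVec (An (ℕ.suc k)) z) ⟩
  (AllNonzero (mulVec (An (ℕ.suc k)) z ∘ (_↑ˡ s k)) × AllNonzero (mulVec (An (ℕ.suc k)) z ∘ (k ↑ʳ_)))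
    ≈⟨ AllNonzero-cong (row-top k z) ×-⇔ AllNonzero-cong (row-bottom k z) ⟩
  (AllNonzero (λ i → z zero - z (suc i)) × AllNonzero (mulVec (An k) (tail z)))
    ≈⟨ ∀-⇔ (λ i → difference-nonzero (z zero) (z (suc i))) ×-⇔ An-nonzero⇔distinct k (tail z) ⟩
  ((∀ i → z zero ≢ z (suc i)) × Distinct (tail z))
    ≈⟨ Distinct-suc z ⟨
  Distinct z ∎
  where open ⇔-Reasoning

block : ∀ n → Permutation′ (n * n) → (Fin (n * n) → ℤ) → Fin n → Fin n → ℤ
block n π x b j = x (π ⟨$⟩ʳ combine b j)

-- `Ablock` locates entries by `quotRem`, which inverts `combine`.
quotRem-combine : ∀ {n} k (b : Fin n) (i : Fin k) → F.quotRem {n} k (combine b i) ≡ (i , b)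
quotRem-combine {n} k b i = cong swap (remQuot-combine {n} {k} b i)

module _ (n : ℕ) where

  Ablock-diagonal : ∀ (b : Fin n) (i : Fin (s n)) (j : Fin n) →
    Ablock n (combine b i) (combine b j) ≡ An n i j
  Ablock-diagonal b i j
    rewrite quotRem-combine (s n) b i | quotRem-combine n b j with b F.≟ b
  ... | yes _   = refl
  ... | no  b≢b = ⊥-elim (b≢b refl)

  Ablock-offDiagonal : ∀ (b b′ : Fin n) (i : Fin (s n)) (j : Fin n) → b ≢ b′ →
    Ablock n (combine b i) (combine b′ j) ≡ 0ℤ
  Ablock-offDiagonal b b′ i j b≢b′
    rewrite quotRem-combine (s n) b i | quotRem-combine n b′ j with b F.≟ b′
  ... | yes b≡b′ = ⊥-elim (b≢b′ b≡b′)
  ... | no  _    = refl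

  -- Row i of block b of A_π x is row i of A(n) applied to block b of x ∘ π:
  -- undo the column permutation, split into blocks, keep only the diagonal one.
  row-block : ∀ π x (b : Fin n) (i : Fin (s n)) →
    mulVec (Aπ n π) x (combine b i) ≡ mulVec (An n) (block n π x b) i
  row-block π x b i = begin
    sumFin (n * n) (λ j → Ablock n r (π ⟨$⟩ˡ j) *ℤ x j)
      ≡⟨ sumFin-cong (n * n) (λ j → cong (λ t → Ablock n r (π ⟨$⟩ˡ j) *ℤ x t) (sym (inverseʳ π))) ⟩
    sumFin (n * n) (g ∘ (π ⟨$⟩ˡ_))
      ≡⟨ sumFin-permute (n * n) g π ⟩
    sumFin (n * n) g
      ≡⟨ sumFin-* n n g ⟩
    sumFin n (λ b′ → sumFin n (g ∘ combine b′))
      ≡⟨ sumFin-delta n _ b (λ b′ b≢b′ → sumFin-zero n _ (λ j →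
           cong (_*ℤ block n π x b′ j) (Ablock-offDiagonal b b′ i j b≢b′))) ⟩
    sumFin n (g ∘ combine b)
      ≡⟨ sumFin-cong n (λ j → cong (_*ℤ block n π x b j) (Ablock-diagonal b i j)) ⟩
    sumFin n (λ j → An n i j *ℤ block n π x b j) ∎
    where
    open ≡-Reasoning
    r : Fin (n * s n)
    r = combine b i
    g : Fin (n * n) → ℤ
    g c = Ablock n r c *ℤ x (π ⟨$⟩ʳ c)

lemma3p4 : (n : ℕ) → n ≥ 1 → (π : Permutation′ (n * n)) → (x : Fin (n * n) → ℤ) →
    AllNonzero (mulVec (Aπ n π) x) ⇔ BlocksDistinct n π x
lemma3p4 n _ π x = begin
  AllNonzero (mulVec (Aπ n π) x)
    ≈⟨ AllNonzero-* n (s n) (mulVec (Aπ n π) x) ⟩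
  (∀ b → AllNonzero (mulVec (Aπ n π) x ∘ combine b))
    ≈⟨ ∀-⇔ (λ b → AllNonzero-cong (row-block n π x b)) ⟩
  (∀ b → AllNonzero (mulVec (An n) (block n π x b)))
    ≈⟨ ∀-⇔ (λ b → An-nonzero⇔distinct n (block n π x b)) ⟩
  BlocksDistinct n π x ∎
  where open ⇔-Reasoning
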